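{- Let $\Sigma$ and $W$ be disjoint finite sets of propositions, let $a,b$ be propositions of $\Sigma\cup W$, let $l\in\mathbb{N}$, and let $T=\Box^{\mathsf{w}}[b\leftrightarrow\Diamond\!\!\!\!-_{[l,\infty)}a]$. Then one can synthesize a formula $\psi\in\mathsf{MTL}[\mathsf{U}_I]$ built from $\Sigma\cup W$ that is equivalent to $T$, i.e. every timed word over $\Sigma\cup W$ satisfies $\psi$ iff it satisfies $T$.
   Context: A finite timed word over a finite set $\Delta$ is $\rho=(\sigma,\tau)$ with $\sigma_i\in2^{\Delta}\setminus\{\emptyset\}$ and $\tau_1\le\dots\le\tau_n$ in $\mathbb{R}_{\ge0}$. $\mathsf{MTL}$ formulae use propositions, boolean connectives and $\mathsf{U}_I,\mathsf{S}_I$ ($I$ an interval with endpoints in $\mathbb{N}\cup\{\infty\}$) with the standard strict pointwise semantics; $\rho\models\varphi$ iff $\rho,1\models\varphi$. $\mathsf{MTL}[\mathsf{U}_I]$ is the fragment without $\mathsf{S}_I$. Abbreviations: $\Diamond\!\!\!\!-_I\phi=true\,\mathsf{S}_I\phi$ (holds at $i$ iff some $j<i$ has $\phi$ and $\tau_i-\tau_j\in I$), $\Box\phi=\neg(true\,\mathsf{U}_{[0,\infty)}\neg\phi)$, $\Box^{\mathsf{w}}\phi=\phi\wedge\Box\phi$.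
   Formalization: The timestamps of timed words range only over the nonnegative rationals instead of $\mathbb{R}_{\ge0}$. -}

module Defs where

open import Data.Nat using (ℕ; suc)
open import Data.Fin using (Fin; _<_; zero)
open import Data.Fin.Subset using (Subset; Nonempty; _∈_)
open import Data.Bool using (Bool; true; false)
open import Data.Maybe using (Maybe; just; nothing)
open import Data.Integer using (+_)
open import Data.Rational as ℚ using (ℚ; 0ℚ; _-_)
open import Data.Product using (Σ; _×_; ∃)
open import Data.Unit using (⊤)
open import Data.Empty using (⊥)
open import Relation.Nullary using (¬_)
open import Level using (0ℓ)

⟦_⟧ℕ : ℕ → ℚ
⟦ n ⟧ℕ = + n ℚ./ 1

-- Intervals with endpoints in ℕ ∪ {∞}; Bool flags say whether the endpoint
-- is included (the upper flag is irrelevant when the upper endpoint is ∞).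
record Interval : Set where
  constructor interval
  field
    lower       : ℕ
    lowerClosed : Bool
    upper       : Maybe ℕ     -- nothing = ∞
    upperClosed : Bool
open Interval public

_∈I_ : ℚ → Interval → Set
q ∈I interval lo lc up uc = lowerOK lc × upperOK up uc
  where
  lowerOK : Bool → Set
  lowerOK true  = ⟦ lo ⟧ℕ ℚ.≤ q
  lowerOK false = ⟦ lo ⟧ℕ ℚ.< q
  upperOK : Maybe ℕ → Bool → Set
  upperOK nothing  _     = ⊤
  upperOK (just u) true  = q ℚ.≤ ⟦ u ⟧ℕ
  upperOK (just u) false = q ℚ.< ⟦ u ⟧ℕ

atLeast : ℕ → Interval
atLeast l = interval l true nothing false

data MTL (P : Set) : Set where
  tt   : MTL P
  prop : P → MTL P
  ¬'_  : MTL P → MTL P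
  _∧'_ : MTL P → MTL P → MTL P
  _U⟨_⟩_ : MTL P → Interval → MTL P → MTL P
  _S⟨_⟩_ : MTL P → Interval → MTL P → MTL P

data FutureOnly {P : Set} : MTL P → Set where
  tt   : FutureOnly tt
  prop : ∀ p → FutureOnly (prop p)
  ¬'_  : ∀ {φ} → FutureOnly φ → FutureOnly (¬' φ)
  _∧'_ : ∀ {φ ψ} → FutureOnly φ → FutureOnly ψ → FutureOnly (φ ∧' ψ)
  until : ∀ {φ ψ} I → FutureOnly φ → FutureOnly ψ → FutureOnly (φ U⟨ I ⟩ ψ)

_↔'_ : ∀ {P} → MTL P → MTL P → MTL P
φ ↔' ψ = (¬' (φ ∧' (¬' ψ))) ∧' (¬' (ψ ∧' (¬' φ)))

◇⁻ : ∀ {P} → Interval → MTL P → MTL P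
◇⁻ I φ = tt S⟨ I ⟩ φ

□ : ∀ {P} → MTL P → MTL P
□ φ = ¬' (tt U⟨ (atLeast 0) ⟩ (¬' φ))

□ʷ : ∀ {P} → MTL P → MTL P
□ʷ φ = φ ∧' □ φ

record TimedWord (n : ℕ) : Set where
  field
    len      : ℕ
    σ        : Fin (suc len) → Subset n
    σ-ne     : ∀ i → Nonempty (σ i)
    τ        : Fin (suc len) → ℚ
    τ-nonneg : ∀ i → 0ℚ ℚ.≤ τ i
    τ-mono   : ∀ i j → i < j → τ i ℚ.≤ τ j
open TimedWord public

_,_⊨_ : ∀ {n} (ρ : TimedWord n) → Fin (suc (len ρ)) → MTL (Fin n) → Set
ρ , i ⊨ tt = ⊤
ρ , i ⊨ prop p = p ∈ σ ρ i
ρ , i ⊨ (¬' φ) = ¬ (ρ , i ⊨ φ)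
ρ , i ⊨ (φ ∧' ψ) = (ρ , i ⊨ φ) × (ρ , i ⊨ ψ)
ρ , i ⊨ (φ U⟨ I ⟩ ψ) = ∃ λ j → (i < j) × (ρ , j ⊨ ψ) × ((τ ρ j - τ ρ i) ∈I I)
                         × (∀ k → i < k → k < j → ρ , k ⊨ φ)
ρ , i ⊨ (φ S⟨ I ⟩ ψ) = ∃ λ j → (j < i) × (ρ , j ⊨ ψ) × ((τ ρ i - τ ρ j) ∈I I)
                         × (∀ k → j < k → k < i → ρ , k ⊨ φ)

_⊨_ : ∀ {n} → TimedWord n → MTL (Fin n) → Set
ρ ⊨ φ = ρ , zero ⊨ φ

{-# OPTIONS --safe #-}
-- The half ◇⁻a → b of the specification is already a future property: every
-- a is followed, from l time units on, only by b.  For the half b → ◇⁻a look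
-- at the first a, at position j: no b occurs up to j (a b needs an earlier a)
-- nor less than l after j (its witnessing a would lie at or after j, hence too
-- close).  So either b never occurs, or ¬b holds until such a "quiet" a.
-- Conversely, if ¬b holds until a quiet a at j, then every b lies after j and,
-- j being quiet, at least l after j.
module Submission where

-- Defs' notation ρ , i ⊨ φ cannot be parsed next to the pair constructor _,_
open import Defs renaming (_,_⊨_ to _⊨[_]_)
open import Data.Nat using (ℕ; _+_)
open import Data.Fin using (Fin)
open import Data.Product using (Σ; _×_)
open import Function.Bundles using (_⇔_)

open import Data.Nat as ℕ using (suc; z≤n)
import Data.Nat.Properties as ℕP
open import Data.Fin as F using (zero)
open import Data.Fin.Properties using (_≟_; _<?_; <-cmp; ≤∧≢⇒<)
open import Data.Fin.Induction using (<-wellFounded)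
open import Data.Bool using (true; false)
open import Data.Maybe using (just)
open import Data.Rational as ℚ using (0ℚ; _-_)
import Data.Rational.Properties as ℚP
open import Data.Product using (∃; _,_)
open import Data.Unit using (tt)
open import Data.Empty using (⊥; ⊥-elim)
open import Function.Bundles using (mk⇔)
import Induction.WellFounded as WF
open import Level using (0ℓ)
open import Relation.Binary.Definitions using (tri<; tri≈; tri>)
open import Relation.Binary.PropositionalEquality using (refl; subst)
open import Relation.Nullary using (¬_; yes; no)

p≤q⇒0≤q-p : ∀ {p q} → p ℚ.≤ q → 0ℚ ℚ.≤ q - p
p≤q⇒0≤q-p {p} {q} p≤q =
  subst (ℚ._≤ q - p) (ℚP.+-inverseʳ p) (ℚP.+-monoˡ-≤ (ℚ.- p) p≤q)

p≤q⇒r-q≤r-p : ∀ {p q} r → p ℚ.≤ q → r - q ℚ.≤ r - p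
p≤q⇒r-q≤r-p r p≤q = ℚP.+-monoʳ-≤ r (ℚP.neg-antimono-≤ p≤q)

below : ℕ → Interval
below l = interval 0 true (just l) false

module _ {P : Set} where

  _∨'_ : MTL P → MTL P → MTL P
  φ ∨' ψ = ¬' ((¬' φ) ∧' (¬' ψ))

  ◇ : Interval → MTL P → MTL P
  ◇ I φ = tt U⟨ I ⟩ φ

  _U⁼_ : MTL P → MTL P → MTL P
  φ U⁼ ψ = ψ ∨' (φ ∧' (φ U⟨ atLeast 0 ⟩ ψ))

  ∨'-future : ∀ {φ ψ} → FutureOnly φ → FutureOnly ψ → FutureOnly (φ ∨' ψ)
  ∨'-future f g = ¬' ((¬' f) ∧' (¬' g))

  ◇-future : ∀ {φ} I → FutureOnly φ → FutureOnly (◇ I φ)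
  ◇-future I f = until I tt f

  U⁼-future : ∀ {φ ψ} → FutureOnly φ → FutureOnly ψ → FutureOnly (φ U⁼ ψ)
  U⁼-future f g = ∨'-future g (f ∧' until (atLeast 0) f g)

  □ʷ-future : ∀ {φ} → FutureOnly φ → FutureOnly (□ʷ φ)
  □ʷ-future f = f ∧' (¬' ◇-future (atLeast 0) (¬' f))

module _ {n : ℕ} (ρ : TimedWord n) where

  Position : Set
  Position = Fin (suc (len ρ))

  τ-mono-≤ : ∀ {i j : Position} → i F.≤ j → τ ρ i ℚ.≤ τ ρ j
  τ-mono-≤ {i} {j} i≤j with i ≟ j
  ... | yes refl = ℚP.≤-refl
  ... | no  i≢j  = τ-mono ρ i j (≤∧≢⇒< i≤j i≢j)

  elapsed-nonneg : ∀ {i j : Position} → i F.≤ j → 0ℚ ℚ.≤ τ ρ j - τ ρ i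
  elapsed-nonneg i≤j = p≤q⇒0≤q-p (τ-mono-≤ i≤j)

  ◇-intro : ∀ {i j : Position} I φ → i F.< j → ρ ⊨[ j ] φ →
            (τ ρ j - τ ρ i) ∈I I → ρ ⊨[ i ] ◇ I φ
  ◇-intro {i} {j} _ _ i<j φj d = j , i<j , φj , d , λ _ _ _ → tt

  ◇⁻-intro : ∀ {i j : Position} I φ → j F.< i → ρ ⊨[ j ] φ →
             (τ ρ i - τ ρ j) ∈I I → ρ ⊨[ i ] ◇⁻ I φ
  ◇⁻-intro {i} {j} _ _ j<i φj d = j , j<i , φj , d , λ _ _ _ → tt

  □ʷ-intro : ∀ φ → (∀ i → ρ ⊨[ i ] φ) → ρ ⊨ □ʷ φ
  □ʷ-intro φ all = all zero , λ (j , _ , ¬φj , _) → ¬φj (all j)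

  -- □ is ¬ ◇ ¬, so only a double negation comes back out
  □ʷ-elim : ∀ φ → ρ ⊨ □ʷ φ → ∀ i → ¬ ¬ (ρ ⊨[ i ] φ)
  □ʷ-elim _ (φ₀ , _)  zero      ¬φ₀ = ¬φ₀ φ₀
  □ʷ-elim φ (_  , □φ) (F.suc i) ¬φ  =
    □φ (◇-intro (atLeast 0) (¬' φ) ℕ.z<s ¬φ (elapsed-nonneg z≤n , tt))

  Until⁼ : MTL (Fin n) → MTL (Fin n) → Position → Set
  Until⁼ φ ψ i = ∃ λ j → i F.≤ j × ρ ⊨[ j ] ψ × (∀ k → i F.≤ k → k F.< j → ρ ⊨[ k ] φ)

  U⁼-intro : ∀ φ ψ {i} → Until⁼ φ ψ i → ρ ⊨[ i ] (φ U⁼ ψ)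
  U⁼-intro _ _ {i} (j , i≤j , ψj , φ-before) (¬ψi , ¬φUψ) with i ≟ j
  ... | yes refl = ¬ψi ψj
  ... | no  i≢j  = ¬φUψ (φ-before i ℕP.≤-refl i<j ,
                         j , i<j , ψj , (elapsed-nonneg i≤j , tt) ,
                         λ k i<k k<j → φ-before k (ℕP.<⇒≤ i<k) k<j)
    where
    i<j : i F.< j
    i<j = ≤∧≢⇒< i≤j i≢j

  U⁼-elim : ∀ φ ψ {i} → ρ ⊨[ i ] (φ U⁼ ψ) → ¬ ¬ Until⁼ φ ψ i
  U⁼-elim φ ψ {i} φU⁼ψ ¬until = φU⁼ψ (¬ψi , ¬φUψ)
    where
    ¬ψi : ¬ (ρ ⊨[ i ] ψ)
    ¬ψi ψi = ¬until (i , ℕP.≤-refl , ψi , λ _ i≤k k<i → ⊥-elim (ℕP.≤⇒≯ i≤k k<i))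

    ¬φUψ : ¬ (ρ ⊨[ i ] (φ ∧' (φ U⟨ atLeast 0 ⟩ ψ)))
    ¬φUψ (φi , j , i<j , ψj , _ , φ-between) = ¬until (j , ℕP.<⇒≤ i<j , ψj , φ-before)
      where
      φ-before : ∀ k → i F.≤ k → k F.< j → ρ ⊨[ k ] φ
      φ-before k i≤k k<j with i ≟ k
      ... | yes refl = φi
      ... | no  i≢k  = φ-between k (≤∧≢⇒< i≤k i≢k) k<j

module _ {n : ℕ} (a b : Fin n) (l : ℕ) where

  b↔◇⁻a : MTL (Fin n)
  b↔◇⁻a = prop b ↔' ◇⁻ (atLeast l) (prop a)

  quiet-a : MTL (Fin n)
  quiet-a = (prop a ∧' (¬' prop b)) ∧' (¬' ◇ (below l) (prop b))

  a⇒b-after-l : MTL (Fin n)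
  a⇒b-after-l = ¬' (prop a ∧' ◇ (atLeast l) (¬' prop b))

  b-needs-a : MTL (Fin n)
  b-needs-a = □ʷ (¬' prop b) ∨' ((¬' prop b) U⁼ quiet-a)

  a-forces-b : MTL (Fin n)
  a-forces-b = □ʷ a⇒b-after-l

  ψ : MTL (Fin n)
  ψ = b-needs-a ∧' a-forces-b

  ψ-future : FutureOnly ψ
  ψ-future = ∨'-future (□ʷ-future ¬b) (U⁼-future ¬b quiet)
          ∧' □ʷ-future (¬' (prop a ∧' ◇-future (atLeast l) ¬b))
    where
    ¬b : FutureOnly (¬' prop b)
    ¬b = ¬' prop b

    quiet : FutureOnly quiet-a
    quiet = (prop a ∧' ¬b) ∧' (¬' ◇-future (below l) (prop b))

  module _ (ρ : TimedWord n) where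

    A B ◇⁻A : Position ρ → Set
    A i = ρ ⊨[ i ] prop a
    B i = ρ ⊨[ i ] prop b
    ◇⁻A i = ρ ⊨[ i ] ◇⁻ (atLeast l) (prop a)

    module _ (spec : ρ ⊨ □ʷ b↔◇⁻a) where

      b⇒◇⁻a : ∀ i → B i → ¬ ¬ ◇⁻A i
      b⇒◇⁻a i bi ¬◇⁻ai = □ʷ-elim ρ b↔◇⁻a spec i λ (¬b∧¬◇⁻a , _) → ¬b∧¬◇⁻a (bi , ¬◇⁻ai)

      ◇⁻a⇒b : ∀ i → ◇⁻A i → ¬ ¬ B i
      ◇⁻a⇒b i ◇⁻ai ¬bi = □ʷ-elim ρ b↔◇⁻a spec i λ (_ , ¬◇⁻a∧¬b) → ¬◇⁻a∧¬b (◇⁻ai , ¬bi)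

      spec⇒a-forces-b : ρ ⊨ a-forces-b
      spec⇒a-forces-b = □ʷ-intro ρ a⇒b-after-l λ j (aj , i , j<i , ¬bi , d , _) →
        ◇⁻a⇒b i (◇⁻-intro ρ (atLeast l) (prop a) j<i aj d) ¬bi

      module _ {j : Position ρ} (no-earlier-a : ∀ {j'} → j' F.< j → ¬ A j') where

        no-b-up-to-first-a : ∀ i → i F.≤ j → ¬ B i
        no-b-up-to-first-a i i≤j bi = b⇒◇⁻a i bi λ (j' , j'<i , aj' , _) →
          no-earlier-a (ℕP.<-≤-trans j'<i i≤j) aj'

        no-b-soon-after-first-a : ¬ (ρ ⊨[ j ] ◇ (below l) (prop b))
        no-b-soon-after-first-a (i , _ , bi , (_ , τi-τj<l) , _) =
          b⇒◇⁻a i bi λ (j' , _ , aj' , (l≤τi-τj' , _) , _) → too-close j' aj' l≤τi-τj'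
          where
          too-close : ∀ j' → A j' → ⟦ l ⟧ℕ ℚ.≤ τ ρ i - τ ρ j' → ⊥
          too-close j' aj' l≤τi-τj' with j' <? j
          ... | yes j'<j = no-earlier-a j'<j aj'
          ... | no  j'≮j = ℚP.<-irrefl refl (ℚP.<-≤-trans τi-τj<l (ℚP.≤-trans l≤τi-τj'
                  (p≤q⇒r-q≤r-p (τ ρ i) (τ-mono-≤ ρ (ℕP.≮⇒≥ j'≮j)))))

        first-a-is-quiet : A j → ρ ⊨[ j ] quiet-a
        first-a-is-quiet aj =
          (aj , no-b-up-to-first-a j ℕP.≤-refl) , no-b-soon-after-first-a

      no-a-without-quiet-a : ¬ (ρ ⊨ ((¬' prop b) U⁼ quiet-a)) → ∀ j → ¬ A j
      no-a-without-quiet-a ¬U = WF.All.wfRec <-wellFounded 0ℓ (λ j → ¬ A j) step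
        where
        step : ∀ j → (∀ {j'} → j' F.< j → ¬ A j') → ¬ A j
        step j no-earlier-a aj = ¬U (U⁼-intro ρ (¬' prop b) quiet-a
          (j , z≤n , first-a-is-quiet no-earlier-a aj ,
           λ k _ k<j → no-b-up-to-first-a no-earlier-a k (ℕP.<⇒≤ k<j)))

      spec⇒b-needs-a : ρ ⊨ b-needs-a
      spec⇒b-needs-a (¬□¬b , ¬U) = ¬□¬b (□ʷ-intro ρ (¬' prop b) λ i bi →
        b⇒◇⁻a i bi λ (j , _ , aj , _) → no-a-without-quiet-a ¬U j aj)

    b-after-quiet-a⇒◇⁻a : ∀ {i j} → B i → ρ ⊨[ j ] quiet-a →
                           (∀ k → k F.< j → ¬ B k) → ◇⁻A i
    b-after-quiet-a⇒◇⁻a {i} {j} bi ((aj , ¬bj) , ¬b-soon) ¬b-before with <-cmp j i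
    ... | tri> _ _ i<j  = ⊥-elim (¬b-before i i<j bi)
    ... | tri≈ _ refl _ = ⊥-elim (¬bj bi)
    ... | tri< j<i _ _ with ⟦ l ⟧ℕ ℚ.≤? τ ρ i - τ ρ j
    ...   | yes l≤τi-τj = ◇⁻-intro ρ (atLeast l) (prop a) j<i aj (l≤τi-τj , tt)
    ...   | no  l≰τi-τj = ⊥-elim (¬b-soon (◇-intro ρ (below l) (prop b) j<i bi
                            (elapsed-nonneg ρ (ℕP.<⇒≤ j<i) , ℚP.≰⇒> l≰τi-τj)))

    b-needs-a⇒b⇒◇⁻a : ρ ⊨ b-needs-a → ∀ i → B i → ¬ ¬ ◇⁻A i
    b-needs-a⇒b⇒◇⁻a needs i bi ¬◇⁻ai = needs (¬□¬b , ¬U)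
      where
      ¬□¬b : ¬ (ρ ⊨ □ʷ (¬' prop b))
      ¬□¬b □¬b = □ʷ-elim ρ (¬' prop b) □¬b i λ ¬bi → ¬bi bi

      ¬U : ¬ (ρ ⊨ ((¬' prop b) U⁼ quiet-a))
      ¬U U = U⁼-elim ρ (¬' prop b) quiet-a U λ (j , _ , quiet-j , ¬b-before) →
        ¬◇⁻ai (b-after-quiet-a⇒◇⁻a bi quiet-j λ k → ¬b-before k z≤n)

    a-forces-b⇒◇⁻a⇒b : ρ ⊨ a-forces-b → ∀ i → ◇⁻A i → ¬ ¬ B i
    a-forces-b⇒◇⁻a⇒b forces i (j , j<i , aj , d , _) ¬bi =
      □ʷ-elim ρ a⇒b-after-l forces j λ ¬a∧◇¬b →
        ¬a∧◇¬b (aj , ◇-intro ρ (atLeast l) (¬' prop b) j<i ¬bi d)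

    ψ⇒spec : ρ ⊨ ψ → ρ ⊨ □ʷ b↔◇⁻a
    ψ⇒spec (needs , forces) = □ʷ-intro ρ b↔◇⁻a λ i →
      (λ (bi , ¬◇⁻ai) → b-needs-a⇒b⇒◇⁻a needs i bi ¬◇⁻ai) ,
      (λ (◇⁻ai , ¬bi) → a-forces-b⇒◇⁻a⇒b forces i ◇⁻ai ¬bi)

lemma9 : (m k : ℕ) (a b : Fin (m + k)) (l : ℕ) →
         Σ (MTL (Fin (m + k))) λ ψ →
           FutureOnly ψ ×
           ((ρ : TimedWord (m + k)) → (ρ ⊨ ψ) ⇔ (ρ ⊨ □ʷ (prop b ↔' ◇⁻ (atLeast l) (prop a))))
lemma9 m k a b l = ψ a b l , ψ-future a b l , λ ρ →
  mk⇔ (ψ⇒spec a b l ρ) (λ spec → spec⇒b-needs-a a b l ρ spec , spec⇒a-forces-b a b l ρ spec)
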